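{- Let $n\ge1$ and let $P=(p_{ij})\in\{0,1\}^{n\times n}$ be nonsingular such that the simplex $\mathrm{conv}\{0,p_1,\dots,p_n\}$ (with $p_1,\dots,p_n$ the columns of $P$) is nonobtuse. Write $Q=(q_{ij})=P^{ -\top}$. Then for all $i,j$, \[ p_{ij}=1 \implies q_{ij}\ge 0 \quad\text{and}\quad p_{ij}=0\implies q_{ij}\le 0 .\] Moreover, defining the nonnegative matrices $C=\tfrac12(|Q|-Q)$ and $D=\tfrac12(|Q|+Q)$, where $|Q|$ is the matrix of entrywise absolute values of $Q$, we have $Q=D-C$, where $D$ is doubly stochastic and $C$ is row-substochastic.
   Context: The dihedral angle between two facets of an $n$-simplex is $\pi$ minus the angle between their inward normals; a simplex is nonobtuse if none of its dihedral angles exceeds $\pi/2$. A nonnegative matrix is doubly stochastic if all its row and column sums equal $1$, and row-substochastic if all its row sums are at most $1$. -}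

module Defs where

open import Data.Nat using (ℕ; zero; suc)
open import Data.Fin using (Fin; zero; suc)
open import Data.Bool using (Bool; true; false)
open import Data.Product using (_×_)
open import Data.Rational using (ℚ; 0ℚ; 1ℚ; ½; _+_; _-_; _*_; ∣_∣; _≤_; _<_)
open import Relation.Binary.PropositionalEquality using (_≡_; _≢_)

-- real (here: rational) vectors and square matrices
Vec : ℕ → Set
Vec n = Fin n → ℚ

Mat : ℕ → Set
Mat n = Fin n → Fin n → ℚ

Σ : ∀ {n} → (Fin n → ℚ) → ℚ
Σ {zero}  f = 0ℚ
Σ {suc n} f = f zero + Σ {n} (λ i → f (suc i))

_·_ : ∀ {n} → Vec n → Vec n → ℚ
u · v = Σ (λ k → u k * v k)

toℚ : Bool → ℚ
toℚ true  = 1ℚ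
toℚ false = 0ℚ

BoolMat : ℕ → Set
BoolMat n = Fin n → Fin n → Bool

⟦_⟧ : ∀ {n} → BoolMat n → Mat n
⟦ P ⟧ i j = toℚ (P i j)

_⊗_ : ∀ {n} → Mat n → Mat n → Mat n
(A ⊗ B) i j = Σ (λ k → A i k * B k j)

transpose : ∀ {n} → Mat n → Mat n
transpose A i j = A j i

δ : ∀ {n} → Fin n → Fin n → ℚ
δ zero    zero    = 1ℚ
δ zero    (suc _) = 0ℚ
δ (suc _) zero    = 0ℚ
δ (suc i) (suc j) = δ i j

I : ∀ {n} → Mat n
I = δ

IsInverse : ∀ {n} → Mat n → Mat n → Set
IsInverse A B = (∀ i j → (A ⊗ B) i j ≡ I i j) × (∀ i j → (B ⊗ A) i j ≡ I i j)

-- Vertices of the simplex conv{0, p_1, ..., p_n}: vertex 0 is the origin,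
-- vertex (suc j) is the j-th column p_j of P.
vertex : ∀ {n} → BoolMat n → Fin (suc n) → Vec n
vertex P zero    i = 0ℚ
vertex P (suc j) i = toℚ (P i j)

-- u is an inward normal of the facet of the simplex with vertices
-- v_0..v_n opposite to vertex v_a: u is orthogonal to the facet
-- (constant inner product on the facet's vertices) and points into the
-- simplex (strictly larger inner product with the opposite vertex).
IsInwardNormal : ∀ {n} → (Fin (suc n) → Vec n) → Fin (suc n) → Vec n → Set
IsInwardNormal v a u =
  (∀ k l → k ≢ a → l ≢ a → u · v k ≡ u · v l) ×
  (∀ k → k ≢ a → u · v k < u · v a)

-- Nonobtuse simplex: every dihedral angle is ≤ π/2, i.e. the angle
-- between inward normals of any two distinct facets is ≥ π/2, i.e. their
-- inner product is ≤ 0.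
Nonobtuse : ∀ {n} → (Fin (suc n) → Vec n) → Set
Nonobtuse {n} v = ∀ (a b : Fin (suc n)) → a ≢ b → ∀ (u w : Vec n) →
  IsInwardNormal v a u → IsInwardNormal v b w → u · w ≤ 0ℚ

-- |A|, C = ½(|Q| - Q), D = ½(|Q| + Q)
absM : ∀ {n} → Mat n → Mat n
absM A i j = ∣ A i j ∣

negPart : ∀ {n} → Mat n → Mat n
negPart Q i j = ½ * (absM Q i j - Q i j)

posPart : ∀ {n} → Mat n → Mat n
posPart Q i j = ½ * (absM Q i j + Q i j)

Nonneg : ∀ {n} → Mat n → Set
Nonneg A = ∀ i j → 0ℚ ≤ A i j

DoublyStochastic : ∀ {n} → Mat n → Set
DoublyStochastic A = Nonneg A × (∀ i → Σ (λ j → A i j) ≡ 1ℚ) × (∀ j → Σ (λ i → A i j) ≡ 1ℚ)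

RowSubstochastic : ∀ {n} → Mat n → Set
RowSubstochastic A = Nonneg A × (∀ i → Σ (λ j → A i j) ≤ 1ℚ)

module Submission where

-- Write p_1,…,p_n for the columns of the 0/1 matrix P and q_1,…,q_n for
-- the columns of Q = P^{-T}.  From QᵀP = I we get q_j · p_l = δ_jl, so q_j
-- is an inward normal of the facet of S = conv{0,p_1,…,p_n} opposite p_j,
-- and -s with s = Q𝟙 (the row sums of Q) is an inward normal of the facet
-- opposite the origin.  Nonobtuseness therefore says that the Gram matrix
-- G = QᵀQ has nonpositive off-diagonal entries and nonnegative column sums
-- (the latter from pairing each q_j with -s).  From PQᵀ = I we get
-- Q = P G, so q_ij = Σ_k p_ik G_kj is a 0/1-combination of column j of G;
-- such a combination is ≥ 0 if it contains the diagonal entry G_jj and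
-- ≤ 0 otherwise, which is the sign pattern.  The sign pattern makes
-- D = ½(|Q|+Q) the entrywise product of P and Q, whose row and column sums
-- are diagonal entries of PQᵀ = I and QᵀP = I.  Finally C = D - Q has row
-- sums 1 - Σ_j q_ij ≤ 1, since the row sums of Q = P G are 0/1-combinations
-- of the nonnegative row sums of the symmetric matrix G.

open import Defs
open import Data.Nat using (ℕ; zero; suc; _≤_)
open import Data.Fin using (Fin; zero; suc)
open import Data.Fin.Properties using (suc-injective; _≟_)
open import Data.Bool using (Bool; true; false)
open import Data.Product using (_×_; _,_; proj₁; proj₂)
open import Data.Sum using (inj₁; inj₂)
open import Data.Empty using (⊥-elim)
open import Function using (_∘_)
open import Relation.Nullary using (yes; no)
open import Relation.Nullary.Decidable using (toWitness)
open import Relation.Binary.PropositionalEquality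
  using (_≡_; _≢_; refl; sym; trans; cong; cong₂; subst; module ≡-Reasoning)
open import Algebra.Bundles using (Ring)
open import Data.Rational using (ℚ; 0ℚ; 1ℚ; ½; _+_; _-_; _*_; -_; ∣_∣; _<_; _<?_)
  renaming (_≤_ to _≤ℚ_)
open import Data.Rational.Properties
  using (+-*-ring; *-comm; *-assoc; *-identityˡ; *-identityʳ; *-zeroˡ; *-zeroʳ;
         +-identityˡ; +-identityʳ; neg-distrib-+; neg-distribˡ-*;
         ≤-refl; ≤-trans; ≤-reflexive; ≤-total; +-mono-≤; +-monoʳ-≤; neg-antimono-≤;
         0≤p⇒∣p∣≡p; ∣-p∣≡∣p∣; module ≤-Reasoning)
open import Algebra.Properties.Semiring.Sum (Ring.semiring +-*-ring)
  using (sum; sum-cong-≗; ∑-distrib-+; ∑-comm; *-distribˡ-sum; *-distribʳ-sum)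
open import Data.Rational.Solver
open +-*-Solver using (solve; _:=_; con; _:+_; _:*_; :-_; _:-_)

-- Σ of Defs computes the standard library's `sum`, so the library's
-- summation laws (linearity, exchange of summations) transfer to Σ.
Σ≡sum : ∀ {n} (f : Fin n → ℚ) → Σ f ≡ sum f
Σ≡sum {zero}  f = refl
Σ≡sum {suc n} f = cong (f zero +_) (Σ≡sum (f ∘ suc))

Σ-cong : ∀ {n} {f g : Fin n → ℚ} → (∀ i → f i ≡ g i) → Σ f ≡ Σ g
Σ-cong {f = f} {g} f≗g = trans (Σ≡sum f) (trans (sum-cong-≗ f≗g) (sym (Σ≡sum g)))

Σ-+ : ∀ {n} (f g : Fin n → ℚ) → Σ (λ i → f i + g i) ≡ Σ f + Σ g
Σ-+ f g = trans (Σ≡sum (λ i → f i + g i))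
  (trans (∑-distrib-+ f g) (sym (cong₂ _+_ (Σ≡sum f) (Σ≡sum g))))

Σ-*ˡ : ∀ {n} c (f : Fin n → ℚ) → Σ (λ i → c * f i) ≡ c * Σ f
Σ-*ˡ c f = trans (Σ≡sum (λ i → c * f i))
  (trans (sym (*-distribˡ-sum c f)) (cong (c *_) (sym (Σ≡sum f))))

Σ-*ʳ : ∀ {n} c (f : Fin n → ℚ) → Σ (λ i → f i * c) ≡ Σ f * c
Σ-*ʳ c f = trans (Σ≡sum (λ i → f i * c))
  (trans (sym (*-distribʳ-sum c f)) (cong (_* c) (sym (Σ≡sum f))))

Σ-swap : ∀ {m n} (f : Fin m → Fin n → ℚ) →
         Σ (λ i → Σ (λ j → f i j)) ≡ Σ (λ j → Σ (λ i → f i j))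
Σ-swap f = trans (Σ²≡sum² f) (trans (∑-comm f) (sym (Σ²≡sum² (λ j i → f i j))))
  where
  Σ²≡sum² : ∀ {m n} (g : Fin m → Fin n → ℚ) →
            Σ (λ i → Σ (g i)) ≡ sum (λ i → sum (g i))
  Σ²≡sum² g = trans (Σ≡sum (λ i → Σ (g i))) (sum-cong-≗ (λ i → Σ≡sum (g i)))

Σ-zero : ∀ n → Σ {n} (λ _ → 0ℚ) ≡ 0ℚ
Σ-zero zero    = refl
Σ-zero (suc n) = cong (0ℚ +_) (Σ-zero n)

-- Negation is not covered by the semiring library, so it is done by hand.
Σ-neg : ∀ {n} (f : Fin n → ℚ) → Σ (λ i → - f i) ≡ - Σ f
Σ-neg {zero}  f = refl
Σ-neg {suc n} f = trans (cong (- f zero +_) (Σ-neg (f ∘ suc)))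
                        (sym (neg-distrib-+ (f zero) (Σ (f ∘ suc))))

Σ-mono : ∀ {n} {f g : Fin n → ℚ} → (∀ i → f i ≤ℚ g i) → Σ f ≤ℚ Σ g
Σ-mono {zero}  f≤g = ≤-refl
Σ-mono {suc n} f≤g = +-mono-≤ (f≤g zero) (Σ-mono (f≤g ∘ suc))

Σ-nonneg : ∀ {n} {f : Fin n → ℚ} → (∀ i → 0ℚ ≤ℚ f i) → 0ℚ ≤ℚ Σ f
Σ-nonneg {n} {f} 0≤f = subst (_≤ℚ Σ f) (Σ-zero n) (Σ-mono 0≤f)

Σ-nonpos : ∀ {n} {f : Fin n → ℚ} → (∀ i → f i ≤ℚ 0ℚ) → Σ f ≤ℚ 0ℚ
Σ-nonpos {n} {f} f≤0 = subst (Σ f ≤ℚ_) (Σ-zero n) (Σ-mono f≤0)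

column : ∀ {n} → Mat n → Fin n → Vec n
column A j i = A i j

rowSum colSum : ∀ {n} → Mat n → Fin n → ℚ
rowSum A i = Σ (λ j → A i j)
colSum A j = Σ (λ i → A i j)

·-zeroʳ : ∀ {n} (u : Vec n) → u · (λ _ → 0ℚ) ≡ 0ℚ
·-zeroʳ {n} u = trans (Σ-cong (λ k → *-zeroʳ (u k))) (Σ-zero n)

·-negˡ : ∀ {n} (u w : Vec n) → (λ k → - u k) · w ≡ - (u · w)
·-negˡ u w = trans (Σ-cong (λ k → sym (neg-distribˡ-* (u k) (w k))))
                   (Σ-neg (λ k → u k * w k))

δ-refl : ∀ {n} (i : Fin n) → δ i i ≡ 1ℚ
δ-refl zero    = refl
δ-refl (suc i) = δ-refl i

δ-neq : ∀ {n} (i j : Fin n) → i ≢ j → δ i j ≡ 0ℚ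
δ-neq zero    zero    i≢j = ⊥-elim (i≢j refl)
δ-neq zero    (suc j) i≢j = refl
δ-neq (suc i) zero    i≢j = refl
δ-neq (suc i) (suc j) i≢j = δ-neq i j (i≢j ∘ cong suc)

δ-sym : ∀ {n} (i j : Fin n) → δ i j ≡ δ j i
δ-sym zero    zero    = refl
δ-sym zero    (suc j) = refl
δ-sym (suc i) zero    = refl
δ-sym (suc i) (suc j) = δ-sym i j

Σ-δ : ∀ {n} (i : Fin n) (g : Vec n) → Σ (λ k → δ i k * g k) ≡ g i
Σ-δ {suc n} zero g = begin
  1ℚ * g zero + Σ (λ k → 0ℚ * g (suc k))
    ≡⟨ cong₂ _+_ (*-identityˡ (g zero)) (Σ-*ˡ 0ℚ (g ∘ suc)) ⟩
  g zero + 0ℚ * Σ (g ∘ suc)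
    ≡⟨ trans (cong (g zero +_) (*-zeroˡ (Σ (g ∘ suc)))) (+-identityʳ (g zero)) ⟩
  g zero ∎
  where open ≡-Reasoning
Σ-δ {suc n} (suc i) g =
  trans (cong (_+ Σ (λ k → δ i k * g (suc k))) (*-zeroˡ (g zero)))
        (trans (+-identityˡ _) (Σ-δ i (g ∘ suc)))

I-⊗ : ∀ {n} (A : Mat n) i j → (I ⊗ A) i j ≡ A i j
I-⊗ A i j = Σ-δ i (column A j)

colSum-I : ∀ {n} (j : Fin n) → colSum I j ≡ 1ℚ
colSum-I j = trans (Σ-cong (λ m → trans (δ-sym m j) (sym (*-identityʳ (δ j m)))))
                   (Σ-δ j (λ _ → 1ℚ))

⊗-assoc : ∀ {n} (A B C : Mat n) i j → ((A ⊗ B) ⊗ C) i j ≡ (A ⊗ (B ⊗ C)) i j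
⊗-assoc A B C i j = begin
  Σ (λ k → Σ (λ m → A i m * B m k) * C k j)
    ≡⟨ Σ-cong (λ k → sym (Σ-*ʳ (C k j) (λ m → A i m * B m k))) ⟩
  Σ (λ k → Σ (λ m → A i m * B m k * C k j))
    ≡⟨ Σ-swap (λ k m → A i m * B m k * C k j) ⟩
  Σ (λ m → Σ (λ k → A i m * B m k * C k j))
    ≡⟨ Σ-cong (λ m → Σ-cong (λ k → *-assoc (A i m) (B m k) (C k j))) ⟩
  Σ (λ m → Σ (λ k → A i m * (B m k * C k j)))
    ≡⟨ Σ-cong (λ m → Σ-*ˡ (A i m) (λ k → B m k * C k j)) ⟩
  Σ (λ m → A i m * Σ (λ k → B m k * C k j)) ∎
  where open ≡-Reasoning

⊗-rowSum : ∀ {n} (A B : Mat n) i → rowSum (A ⊗ B) i ≡ Σ (λ k → A i k * rowSum B k)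
⊗-rowSum A B i = trans (Σ-swap (λ j k → A i k * B k j))
                       (Σ-cong (λ k → Σ-*ˡ (A i k) (λ j → B k j)))

⊗-colSum : ∀ {n} (A B : Mat n) j → colSum (A ⊗ B) j ≡ Σ (λ k → colSum A k * B k j)
⊗-colSum A B j = trans (Σ-swap (λ i k → A i k * B k j))
                       (Σ-cong (λ k → Σ-*ʳ (B k j) (λ i → A i k)))

factor-through-Gram : ∀ {n} (A B : Mat n) → (∀ i j → (A ⊗ transpose B) i j ≡ I i j) →
                      ∀ i j → B i j ≡ (A ⊗ (transpose B ⊗ B)) i j
factor-through-Gram A B ABᵀ≡I i j = begin
  B i j                              ≡⟨ sym (I-⊗ B i j) ⟩
  (I ⊗ B) i j                        ≡⟨ Σ-cong (λ k → cong (_* B k j) (sym (ABᵀ≡I i k))) ⟩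
  ((A ⊗ transpose B) ⊗ B) i j        ≡⟨ ⊗-assoc A (transpose B) B i j ⟩
  (A ⊗ (transpose B ⊗ B)) i j        ∎
  where open ≡-Reasoning

SignedBy : Bool → ℚ → Set
SignedBy b q = (b ≡ true → 0ℚ ≤ℚ q) × (b ≡ false → q ≤ℚ 0ℚ)

posPart-nonneg : ∀ {q} → 0ℚ ≤ℚ q → ½ * (∣ q ∣ + q) ≡ q
posPart-nonneg {q} 0≤q = trans (cong (λ a → ½ * (a + q)) (0≤p⇒∣p∣≡p 0≤q))
                              (solve 1 (λ x → con ½ :* (x :+ x) := x) refl q)

posPart-nonpos : ∀ {q} → q ≤ℚ 0ℚ → ½ * (∣ q ∣ + q) ≡ 0ℚ
posPart-nonpos {q} q≤0 = trans (cong (λ a → ½ * (a + q)) ∣q∣≡-q)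
                              (solve 1 (λ x → con ½ :* (:- x :+ x) := con 0ℚ) refl q)
  where
  ∣q∣≡-q : ∣ q ∣ ≡ - q
  ∣q∣≡-q = trans (sym (∣-p∣≡∣p∣ q)) (0≤p⇒∣p∣≡p (neg-antimono-≤ q≤0))

posPart-≥0 : ∀ q → 0ℚ ≤ℚ ½ * (∣ q ∣ + q)
posPart-≥0 q with ≤-total 0ℚ q
... | inj₁ 0≤q = subst (0ℚ ≤ℚ_) (sym (posPart-nonneg 0≤q)) 0≤q
... | inj₂ q≤0 = ≤-reflexive (sym (posPart-nonpos q≤0))

negPart-≥0 : ∀ q → 0ℚ ≤ℚ ½ * (∣ q ∣ - q)
negPart-≥0 q = subst (0ℚ ≤ℚ_) (cong (λ a → ½ * (a - q)) (∣-p∣≡∣p∣ q)) (posPart-≥0 (- q))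

posPart-signed : ∀ b q → SignedBy b q → ½ * (∣ q ∣ + q) ≡ toℚ b * q
posPart-signed true  q (nonneg , _) = trans (posPart-nonneg (nonneg refl)) (sym (*-identityˡ q))
posPart-signed false q (_ , nonpos) = trans (posPart-nonpos (nonpos refl)) (sym (*-zeroˡ q))

toℚ-scale-≥0 : ∀ b {x} → 0ℚ ≤ℚ x → 0ℚ ≤ℚ toℚ b * x
toℚ-scale-≥0 true  {x} 0≤x = subst (0ℚ ≤ℚ_) (sym (*-identityˡ x)) 0≤x
toℚ-scale-≥0 false {x} _   = ≤-reflexive (sym (*-zeroˡ x))

-- Let g have nonpositive entries off position j and a nonnegative sum.
-- A 0/1-combination Σ_k b_k g_k is then ≥ 0 if it includes g_j (dropping
-- the other terms only increases g's sum) and ≤ 0 otherwise.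
zeroOne-combination-sign : ∀ {n} (b : Fin n → Bool) (g : Fin n → ℚ) (j : Fin n) →
  (∀ k → k ≢ j → g k ≤ℚ 0ℚ) → 0ℚ ≤ℚ Σ g →
  SignedBy (b j) (Σ (λ k → toℚ (b k) * g k))
zeroOne-combination-sign b g j off-diag sum≥0 = including , excluding
  where
  scaled : ∀ {c} → b j ≡ c → toℚ (b j) * g j ≡ toℚ c * g j
  scaled e = cong (λ c → toℚ c * g j) e

  including : b j ≡ true → 0ℚ ≤ℚ Σ (λ k → toℚ (b k) * g k)
  including bj = ≤-trans sum≥0 (Σ-mono term)
    where
    term : ∀ k → g k ≤ℚ toℚ (b k) * g k
    term k with k ≟ j
    ... | yes refl = ≤-reflexive (sym (trans (scaled bj) (*-identityˡ (g k))))
    ... | no k≢j with b k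
    ...   | true  = ≤-reflexive (sym (*-identityˡ (g k)))
    ...   | false = subst (g k ≤ℚ_) (sym (*-zeroˡ (g k))) (off-diag k k≢j)

  excluding : b j ≡ false → Σ (λ k → toℚ (b k) * g k) ≤ℚ 0ℚ
  excluding bj = Σ-nonpos term
    where
    term : ∀ k → toℚ (b k) * g k ≤ℚ 0ℚ
    term k with k ≟ j
    ... | yes refl = ≤-reflexive (trans (scaled bj) (*-zeroˡ (g k)))
    ... | no k≢j with b k
    ...   | true  = subst (_≤ℚ 0ℚ) (sym (*-identityˡ (g k))) (off-diag k k≢j)
    ...   | false = ≤-reflexive (*-zeroˡ (g k))

inwardNormal-fromLevels : ∀ {n} (v : Fin (suc n) → Vec n) (a : Fin (suc n)) (u : Vec n) (c : ℚ) →
  (∀ k → k ≢ a → u · v k ≡ c) → c < u · v a → IsInwardNormal v a u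
inwardNormal-fromLevels v a u c level c<u·va =
  (λ k l k≢a l≢a → trans (level k k≢a) (sym (level l l≢a))) ,
  (λ k k≢a → subst (_< u · v a) (sym (level k k≢a)) c<u·va)

-- For P, Q with QᵀP = I: the columns of Q and the negated row sums of Q
-- are the inward normals of the simplex conv{0, p_1, …, p_n}.
module FacetNormals {n} (P : BoolMat n) (Q : Mat n)
                    (QᵀP≡I : ∀ i j → (transpose Q ⊗ ⟦ P ⟧) i j ≡ I i j) where

  -- q_j · p_l = δ_jl and q_j · 0 = 0.
  column-normal : ∀ j → IsInwardNormal (vertex P) (suc j) (column Q j)
  column-normal j = inwardNormal-fromLevels (vertex P) (suc j) (column Q j) 0ℚ level
    (subst (0ℚ <_) (sym (trans (QᵀP≡I j j) (δ-refl j))) (toWitness {a? = 0ℚ <? 1ℚ} _))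
    where
    level : ∀ k → k ≢ suc j → column Q j · vertex P k ≡ 0ℚ
    level zero    _     = ·-zeroʳ (column Q j)
    level (suc l) l≢j = trans (QᵀP≡I j l) (δ-neq j l (l≢j ∘ cong suc ∘ sym))

  rowSum-pairing : ∀ (B : Mat n) l → rowSum Q · column B l ≡ colSum (transpose Q ⊗ B) l
  rowSum-pairing B l = sym (⊗-colSum (transpose Q) B l)

  origin-normal-vector : Vec n
  origin-normal-vector r = - rowSum Q r

  -- -s · p_l = -1 and -s · 0 = 0.
  origin-normal : IsInwardNormal (vertex P) zero origin-normal-vector
  origin-normal = inwardNormal-fromLevels (vertex P) zero origin-normal-vector (- 1ℚ) level
    (subst (- 1ℚ <_) (sym (·-zeroʳ origin-normal-vector)) (toWitness {a? = - 1ℚ <? 0ℚ} _))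
    where
    open ≡-Reasoning
    level : ∀ k → k ≢ zero → origin-normal-vector · vertex P k ≡ - 1ℚ
    level zero    0≢0 = ⊥-elim (0≢0 refl)
    level (suc l) _   = begin
      origin-normal-vector · column ⟦ P ⟧ l  ≡⟨ ·-negˡ (rowSum Q) (column ⟦ P ⟧ l) ⟩
      - (rowSum Q · column ⟦ P ⟧ l)          ≡⟨ cong -_ (rowSum-pairing ⟦ P ⟧ l) ⟩
      - colSum (transpose Q ⊗ ⟦ P ⟧) l       ≡⟨ cong -_ (Σ-cong (λ m → QᵀP≡I m l)) ⟩
      - colSum I l                           ≡⟨ cong -_ (colSum-I l) ⟩
      - 1ℚ                                   ∎

  origin-normal-pairing : ∀ j → origin-normal-vector · column Q j ≡ - colSum (transpose Q ⊗ Q) j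
  origin-normal-pairing j = trans (·-negˡ (rowSum Q) (column Q j)) (cong -_ (rowSum-pairing Q j))

module NonobtuseZeroOne {n} (P : BoolMat n) (Q : Mat n)
                        (inverse : IsInverse ⟦ P ⟧ (transpose Q))
                        (nonobtuse : Nonobtuse (vertex P)) where

  open FacetNormals P Q (proj₂ inverse)

  G : Mat n
  G = transpose Q ⊗ Q

  -- Distinct facet normals of a nonobtuse simplex pair nonpositively.
  G-offdiag≤0 : ∀ k j → k ≢ j → G k j ≤ℚ 0ℚ
  G-offdiag≤0 k j k≢j =
    nonobtuse (suc k) (suc j) (k≢j ∘ suc-injective) (column Q k) (column Q j)
              (column-normal k) (column-normal j)

  -- Pairing q_j with the normal -s opposite the origin: -colSum G j ≤ 0.
  G-colSum≥0 : ∀ j → 0ℚ ≤ℚ colSum G j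
  G-colSum≥0 j = subst (0ℚ ≤ℚ_) (solve 1 (λ x → :- :- x := x) refl (colSum G j))
                   (neg-antimono-≤ (subst (_≤ℚ 0ℚ) (origin-normal-pairing j) pairing≤0))
    where
    pairing≤0 : origin-normal-vector · column Q j ≤ℚ 0ℚ
    pairing≤0 = nonobtuse zero (suc j) (λ ()) origin-normal-vector (column Q j)
                          origin-normal (column-normal j)

  -- G is symmetric, so its row sums are its column sums.
  G-rowSum≥0 : ∀ k → 0ℚ ≤ℚ rowSum G k
  G-rowSum≥0 k = subst (0ℚ ≤ℚ_) (Σ-cong (λ j → Σ-cong (λ r → *-comm (Q r j) (Q r k))))
                       (G-colSum≥0 k)

  -- From PQᵀ = I: each entry q_ij is the 0/1-combination Σ_k p_ik G_kj.
  Q≡P⊗G : ∀ i j → Q i j ≡ (⟦ P ⟧ ⊗ G) i j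
  Q≡P⊗G = factor-through-Gram ⟦ P ⟧ Q (proj₁ inverse)

  -- The sign lemma applied to column j of G, selected by row i of P.
  sign-pattern : ∀ i j → SignedBy (P i j) (Q i j)
  sign-pattern i j = subst (SignedBy (P i j)) (sym (Q≡P⊗G i j))
    (zeroOne-combination-sign (P i) (λ k → G k j) j
                              (λ k k≢j → G-offdiag≤0 k j k≢j) (G-colSum≥0 j))

  -- Row sums of Q = P G are 0/1-combinations of the row sums of G.
  Q-rowSum≥0 : ∀ i → 0ℚ ≤ℚ rowSum Q i
  Q-rowSum≥0 i = subst (0ℚ ≤ℚ_) (sym (trans (Σ-cong (Q≡P⊗G i)) (⊗-rowSum ⟦ P ⟧ G i)))
                       (Σ-nonneg (λ k → toℚ-scale-≥0 (P i k) (G-rowSum≥0 k)))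

  -- D = ½(|Q| + Q) is the entrywise product of P and Q.
  posPart≡P∘Q : ∀ i j → posPart Q i j ≡ ⟦ P ⟧ i j * Q i j
  posPart≡P∘Q i j = posPart-signed (P i j) (Q i j) (sign-pattern i j)

  -- Its row and column sums are diagonal entries of PQᵀ = I and QᵀP = I.
  posPart-rowSum : ∀ i → rowSum (posPart Q) i ≡ 1ℚ
  posPart-rowSum i = trans (Σ-cong (posPart≡P∘Q i)) (trans (proj₁ inverse i i) (δ-refl i))

  posPart-colSum : ∀ j → colSum (posPart Q) j ≡ 1ℚ
  posPart-colSum j = trans (Σ-cong (λ i → trans (posPart≡P∘Q i j) (*-comm (⟦ P ⟧ i j) (Q i j))))
                           (trans (proj₂ inverse j j) (δ-refl j))

  -- C = D - Q, so its row sums are 1 - Σ_j q_ij ≤ 1.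
  negPart-rowSum≤1 : ∀ i → rowSum (negPart Q) i ≤ℚ 1ℚ
  negPart-rowSum≤1 i = begin
    rowSum (negPart Q) i                          ≡⟨ +-identityʳ _ ⟨
    rowSum (negPart Q) i + 0ℚ                     ≤⟨ +-monoʳ-≤ (rowSum (negPart Q) i) (Q-rowSum≥0 i) ⟩
    rowSum (negPart Q) i + rowSum Q i             ≡⟨ Σ-+ (λ j → negPart Q i j) (λ j → Q i j) ⟨
    Σ (λ j → negPart Q i j + Q i j)               ≡⟨ Σ-cong (λ j → C+Q≡D ∣ Q i j ∣ (Q i j)) ⟩
    rowSum (posPart Q) i                          ≡⟨ posPart-rowSum i ⟩
    1ℚ                                            ∎
    where
    open ≤-Reasoning
    C+Q≡D : ∀ a q → ½ * (a - q) + q ≡ ½ * (a + q)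
    C+Q≡D = solve 2 (λ a q → con ½ :* (a :- q) :+ q := con ½ :* (a :+ q)) refl

-- Sign pattern, the splitting Q = D - C (an identity of rationals), D
-- doubly stochastic and C row-substochastic.
theorem3p5 : (n : ℕ) → 1 ≤ n → (P : BoolMat n) → (Q : Mat n) →
    IsInverse ⟦ P ⟧ (transpose Q) →
    Nonobtuse (vertex P) →
    ((∀ i j → (P i j ≡ true → 0ℚ ≤ℚ Q i j) × (P i j ≡ false → Q i j ≤ℚ 0ℚ)) ×
     (∀ i j → Q i j ≡ posPart Q i j - negPart Q i j) ×
     DoublyStochastic (posPart Q) ×
     RowSubstochastic (negPart Q))
theorem3p5 _ _ P Q inverse nonobtuse =
  sign-pattern ,
  (λ i j → Q≡D-C ∣ Q i j ∣ (Q i j)) ,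
  ((λ i j → posPart-≥0 (Q i j)) , posPart-rowSum , posPart-colSum) ,
  ((λ i j → negPart-≥0 (Q i j)) , negPart-rowSum≤1)
  where
  open NonobtuseZeroOne P Q inverse nonobtuse
  Q≡D-C : ∀ a q → q ≡ ½ * (a + q) - ½ * (a - q)
  Q≡D-C = solve 2 (λ a q → q := con ½ :* (a :+ q) :- con ½ :* (a :- q)) refl
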